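{- Let $k$ and $l$ be positive integers with $l \leq k$ and $l$ dividing $k$. Then there exists (and one can explicitly construct) a $k$-uniform hypergraph that is not 2-colorable and has $$m(k,l) = \binom{2l - 1}{l} \cdot \left(\frac{2^{l} k}{l} \right)^{l} \cdot \binom{\frac{2^{l}}{l} k}{\frac{k}{l}}$$ edges.
   Context: A hypergraph is $k$-uniform if every edge is a set of exactly $k$ vertices. A hypergraph is 2-colorable if there is a coloring of its vertices with two colors (red and blue) such that no edge is monochromatic; "not 2-colorable" means every red/blue coloring of the vertices makes some edge monochromatic. -}

module Defs where

open import Data.Nat using (ℕ; suc; _*_; _^_; _∸_; NonZero)
open import Data.Nat.DivMod using (_/_)
open import Data.Nat.Combinatorics using (_C_)
open import Data.Bool using (Bool)
open import Data.Fin using (Fin)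
open import Data.Fin.Subset using (Subset; _∈_; ∣_∣)
open import Data.List using (List; length)
open import Data.List.Relation.Unary.All using (All)
open import Data.List.Relation.Unary.Unique.Propositional using (Unique)
open import Data.List.Membership.Propositional renaming (_∈_ to _∈ₗ_)
open import Data.Product using (Σ; _×_; ∃)
open import Relation.Binary.PropositionalEquality using (_≡_)
open import Relation.Nullary using (¬_)

record Hypergraph (n : ℕ) : Set where
  field
    edges    : List (Subset n)
    distinct : Unique edges

open Hypergraph public

numEdges : ∀ {n} → Hypergraph n → ℕ
numEdges H = length (edges H)

Uniform : ∀ {n} → ℕ → Hypergraph n → Set
Uniform k H = All (λ e → ∣ e ∣ ≡ k) (edges H)

Coloring : ℕ → Set
Coloring n = Fin n → Bool

Monochromatic : ∀ {n} → Coloring n → Subset n → Set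
Monochromatic c e = Σ Bool λ b → ∀ v → v ∈ e → c v ≡ b

Proper2Coloring : ∀ {n} → Hypergraph n → Coloring n → Set
Proper2Coloring H c = ∀ e → e ∈ₗ edges H → ¬ Monochromatic c e

TwoColorable : ∀ {n} → Hypergraph n → Set
TwoColorable H = Σ (Coloring _) λ c → Proper2Coloring H c

-- m(k,l) = C(2l-1,l) * (2^l k / l)^l * C((2^l/l) k, k/l), for l ≥ 1, l ∣ k.
-- With l ∣ k:  2^l k / l = (2^l/l) k = 2^l * (k/l), an exact integer.
m : (k l : ℕ) → .{{NonZero l}} → ℕ
m k l = ((2 * l ∸ 1) C l) * ((2 ^ l * (k / l)) ^ l) * ((2 ^ l * (k / l)) C (k / l))

module Submission where

-- Split the vertices into g = 2l − 1 blocks, each a copy of ℤ/s with s = 2^l q and q = k/l.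
-- An edge is given by l of the blocks, a rotation u of ℤ/s for each of them, and a q-set A ⊆ ℤ/s:
-- it is the union of the rotated copies A + u in the chosen blocks, so there are
-- C(g,l) s^l C(s,q) such edges, each of size lq = k.
-- Given a colouring, some colour fills at least half of each block, so some colour b does so
-- in at least l blocks. Run through these l blocks keeping a set S ⊆ ℤ/s of admissible points,
-- starting with S = ℤ/s: every point lies in exactly |R| of the s rotations of the colour class R
-- of the block, so some rotation u keeps at least half of S inside R − u. After l blocks at least
-- s/2^l = q points survive, and any q of them form an A whose edge is coloured b.
-- Repeated edges are finally traded for disjoint fresh ones, which keeps the count m(k,l).

open import Data.Bool using (Bool; true; false)
import Data.Bool as Bool
open import Data.Empty using (⊥-elim)
open import Data.Fin using (Fin; zero; suc; toℕ; _↑ˡ_; _↑ʳ_)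
open import Data.Fin.Permutation using (Permutation′; _⟨$⟩ʳ_; _⟨$⟩ˡ_; permutation; inverseʳ; flip)
open import Data.Fin.Properties using (toℕ-fromℕ<; toℕ<n; toℕ-injective)
open import Data.Fin.Subset using (Subset; _∈_; _⊆_; ∣_∣; ⊥; ⊤; inside; outside; _∩_; ∁)
open import Data.Fin.Subset.Properties
  using (∣⊥∣≡0; ∣⊤∣≡n; ∣∁p∣≡n∸∣p∣; ∣p∣≤n; ⊥⊆; ∉⊥; s⊆s; out⊆; ⊆-trans; p∩q⊆p; p∩q⊆q; x∈∁p⇒x∉p)
open import Data.List using (List; length; map; cartesianProductWith; allFin; deduplicate)
  renaming ([] to []ₗ; _∷_ to _∷ₗ_; _++_ to _++ₗ_)
open import Data.List.Membership.Propositional using (lose; find) renaming (_∈_ to _∈ₗ_)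
open import Data.List.Membership.Propositional.Properties
  using (∈-map⁺; ∈-map⁻; ∈-++⁺ˡ; ∈-++⁺ʳ; ∈-++⁻; ∈-cartesianProductWith⁺; ∈-cartesianProductWith⁻;
         ∈-allFin; ∈-deduplicate⁺)
open import Data.List.Properties using (length-map; length-++; length-tabulate; length-deduplicate)
open import Data.List.Relation.Unary.All as All using (All)
import Data.List.Relation.Unary.All.Properties as Allₚ
import Data.List.Relation.Unary.AllPairs as AllPairs
open import Data.List.Relation.Unary.Any using (Any; here)
open import Data.List.Relation.Unary.Unique.Propositional using (Unique)
import Data.List.Relation.Unary.Unique.Propositional.Properties as Uniqueₚ
open import Data.List.Relation.Unary.Unique.DecPropositional.Properties using (deduplicate-!)
open import Data.Nat using (ℕ; zero; suc; _+_; _*_; _∸_; _^_; _≤_; _<_; _≤?_; z≤n; s≤s; s≤s⁻¹;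
  NonZero; >-nonZero)
open import Data.Nat.Combinatorics using (_C_; nCk+nC[k+1]≡[n+1]C[k+1])
open import Data.Nat.Divisibility using (_∣_)
open import Data.Nat.DivMod
  using (_/_; _%_; _mod_; %-distribˡ-+; m%n%n≡m%n; [m+n]%n≡m%n; m<n⇒m%n≡m; m*[n/m]≡n; m≥n⇒m/n>0)
open import Data.Nat.Properties
open import Data.Product using (Σ; ∃; _×_; _,_)
open import Data.Sum using (inj₁; inj₂)
open import Data.Vec using ([]; _∷_; _++_; lookup; tabulate; here; there)
open import Data.Vec.Properties using (lookup∘tabulate; []=⇒lookup; lookup⇒[]=; ≡-dec; ++-injectiveˡ; ++-injectiveʳ)
open import Function using (_∘_; id)
open import Relation.Binary.PropositionalEquality
open import Relation.Nullary using (¬_; Dec; does; yes; no)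

open import Algebra.Properties.CommutativeSemigroup +-commutativeSemigroup using (interchange)
open import Algebra.Properties.CommutativeSemigroup *-commutativeSemigroup
  using () renaming (x∙yz≈y∙xz to x*yz≡y*xz)
open import Algebra.Properties.Semiring.Sum +-*-semiring
  using (sum; sum-syntax; sum-cong-≗; sum-permute; ∑-comm; *-distribˡ-sum; *-distribʳ-sum)

open import Defs

iverson : Bool → ℕ
iverson true  = 1
iverson false = 0

∣p∣≡∑ : ∀ {n} (p : Subset n) → ∣ p ∣ ≡ ∑[ i < n ] iverson (lookup p i)
∣p∣≡∑ []          = refl
∣p∣≡∑ (true  ∷ p) = cong suc (∣p∣≡∑ p)
∣p∣≡∑ (false ∷ p) = ∣p∣≡∑ p

∣p∩q∣≡∑ : ∀ {n} (p q : Subset n) → ∣ p ∩ q ∣ ≡ ∑[ i < n ] (iverson (lookup p i) * iverson (lookup q i))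
∣p∩q∣≡∑ []          []          = refl
∣p∩q∣≡∑ (true  ∷ p) (true  ∷ q) = cong suc (∣p∩q∣≡∑ p q)
∣p∩q∣≡∑ (true  ∷ p) (false ∷ q) = ∣p∩q∣≡∑ p q
∣p∩q∣≡∑ (false ∷ p) (_     ∷ q) = ∣p∩q∣≡∑ p q

∣p++q∣≡∣p∣+∣q∣ : ∀ {m n} (p : Subset m) (q : Subset n) → ∣ p ++ q ∣ ≡ ∣ p ∣ + ∣ q ∣
∣p++q∣≡∣p∣+∣q∣ []          q = refl
∣p++q∣≡∣p∣+∣q∣ (true  ∷ p) q = cong suc (∣p++q∣≡∣p∣+∣q∣ p q)
∣p++q∣≡∣p∣+∣q∣ (false ∷ p) q = ∣p++q∣≡∣p∣+∣q∣ p q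

∣p++⊥∣≡∣p∣ : ∀ {m} n (p : Subset m) → ∣ p ++ ⊥ {n} ∣ ≡ ∣ p ∣
∣p++⊥∣≡∣p∣ n p = trans (∣p++q∣≡∣p∣+∣q∣ p ⊥) (trans (cong (∣ p ∣ +_) (∣⊥∣≡0 n)) (+-identityʳ ∣ p ∣))

∣⊥++p∣≡∣p∣ : ∀ m {n} (p : Subset n) → ∣ ⊥ {m} ++ p ∣ ≡ ∣ p ∣
∣⊥++p∣≡∣p∣ zero    p = refl
∣⊥++p∣≡∣p∣ (suc m) p = ∣⊥++p∣≡∣p∣ m p

preimage : ∀ {m n} → (Fin m → Fin n) → Subset n → Subset m
preimage f p = tabulate (lookup p ∘ f)

∈-preimage⁻ : ∀ {m n} {f : Fin m → Fin n} {p x} → x ∈ preimage f p → f x ∈ p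
∈-preimage⁻ {f = f} {p} {x} x∈ = lookup⇒[]= (f x) p (trans (sym (lookup∘tabulate _ x)) ([]=⇒lookup x∈))

image : ∀ {n} → Permutation′ n → Subset n → Subset n
image π = preimage (π ⟨$⟩ˡ_)

∣image∣≡∣p∣ : ∀ {n} (π : Permutation′ n) (p : Subset n) → ∣ image π p ∣ ≡ ∣ p ∣
∣image∣≡∣p∣ {n} π p = begin
  ∣ image π p ∣                              ≡⟨ ∣p∣≡∑ (image π p) ⟩
  ∑[ i < n ] iverson (lookup (image π p) i)  ≡⟨ sum-cong-≗ {n} (λ i → cong iverson (lookup∘tabulate _ i)) ⟩
  ∑[ i < n ] iverson (lookup p (π ⟨$⟩ˡ i))   ≡⟨ sum-permute (iverson ∘ lookup p) (flip π) ⟨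
  ∑[ i < n ] iverson (lookup p i)            ≡⟨ ∣p∣≡∑ p ⟨
  ∣ p ∣                                      ∎
  where open ≡-Reasoning

⊆-preimage⇒image⊆ : ∀ {n} (π : Permutation′ n) {p q} → p ⊆ preimage (π ⟨$⟩ʳ_) q → image π p ⊆ q
⊆-preimage⇒image⊆ π {q = q} p⊆ y∈ = subst (_∈ q) (inverseʳ π) (∈-preimage⁻ (p⊆ (∈-preimage⁻ y∈)))

∃⊆-ofSize : ∀ {n} q (p : Subset n) → q ≤ ∣ p ∣ → ∃ λ r → r ⊆ p × ∣ r ∣ ≡ q
∃⊆-ofSize {n} zero    p           _ = ⊥ , ⊥⊆ , ∣⊥∣≡0 n
∃⊆-ofSize     (suc q) (true  ∷ p) q<∣p∣ with ∃⊆-ofSize q p (s≤s⁻¹ q<∣p∣)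
... | r , r⊆p , ∣r∣≡q = inside ∷ r , s⊆s r⊆p , cong suc ∣r∣≡q
∃⊆-ofSize     (suc q) (false ∷ p) q<∣p∣ with ∃⊆-ofSize (suc q) p q<∣p∣
... | r , r⊆p , ∣r∣≡q = outside ∷ r , out⊆ r⊆p , ∣r∣≡q

subsetsOfSize : ∀ n → ℕ → List (Subset n)
subsetsOfSize zero    zero    = [] ∷ₗ []ₗ
subsetsOfSize zero    (suc k) = []ₗ
subsetsOfSize (suc n) zero    = map (outside ∷_) (subsetsOfSize n zero)
subsetsOfSize (suc n) (suc k) =
  map (outside ∷_) (subsetsOfSize n (suc k)) ++ₗ map (inside ∷_) (subsetsOfSize n k)

length-subsetsOfSize : ∀ n k → length (subsetsOfSize n k) ≡ n C k
length-subsetsOfSize zero    zero    = refl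
length-subsetsOfSize zero    (suc k) = refl
length-subsetsOfSize (suc n) zero    =
  trans (length-map _ (subsetsOfSize n zero)) (length-subsetsOfSize n zero)
length-subsetsOfSize (suc n) (suc k) = begin
  length (map (outside ∷_) outs ++ₗ map (inside ∷_) ins)        ≡⟨ length-++ (map (outside ∷_) outs) ⟩
  length (map (outside ∷_) outs) + length (map (inside ∷_) ins) ≡⟨ cong₂ _+_ (length-map _ outs) (length-map _ ins) ⟩
  length outs + length ins                                      ≡⟨ cong₂ _+_ (length-subsetsOfSize n (suc k))
                                                                               (length-subsetsOfSize n k) ⟩
  n C suc k + n C k                                             ≡⟨ +-comm (n C suc k) (n C k) ⟩
  n C k + n C suc k                                             ≡⟨ nCk+nC[k+1]≡[n+1]C[k+1] n k ⟩
  suc n C suc k                                                 ∎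
  where
  open ≡-Reasoning
  outs ins : List (Subset n)
  outs = subsetsOfSize n (suc k)
  ins  = subsetsOfSize n k

∈-subsetsOfSize : ∀ {n} (p : Subset n) → p ∈ₗ subsetsOfSize n ∣ p ∣
∈-subsetsOfSize []          = here refl
∈-subsetsOfSize (true  ∷ p) = ∈-++⁺ʳ (map (outside ∷_) _) (∈-map⁺ (inside ∷_) (∈-subsetsOfSize p))
∈-subsetsOfSize (false ∷ p) with ∣ p ∣ | ∈-subsetsOfSize p
... | zero  | p∈ = ∈-map⁺ (outside ∷_) p∈
... | suc k | p∈ = ∈-++⁺ˡ (∈-map⁺ (outside ∷_) p∈)

∈-subsetsOfSize⁻ : ∀ {n} k {p : Subset n} → p ∈ₗ subsetsOfSize n k → ∣ p ∣ ≡ k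
∈-subsetsOfSize⁻ {zero}  zero    (here refl) = refl
∈-subsetsOfSize⁻ {suc n} zero    p∈ with ∈-map⁻ (outside ∷_) p∈
... | p′ , p′∈ , refl = ∈-subsetsOfSize⁻ zero p′∈
∈-subsetsOfSize⁻ {suc n} (suc k) p∈ with ∈-++⁻ (map (outside ∷_) (subsetsOfSize n (suc k))) p∈
... | inj₁ p∈outs with ∈-map⁻ (outside ∷_) p∈outs
...   | p′ , p′∈ , refl = ∈-subsetsOfSize⁻ (suc k) p′∈
∈-subsetsOfSize⁻ {suc n} (suc k) p∈ | inj₂ p∈ins with ∈-map⁻ (inside ∷_) p∈ins
...   | p′ , p′∈ , refl = cong suc (∈-subsetsOfSize⁻ k p′∈)

length-cartesianProductWith : ∀ {A B C : Set} (f : A → B → C) xs ys →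
  length (cartesianProductWith f xs ys) ≡ length xs * length ys
length-cartesianProductWith f []ₗ        ys = refl
length-cartesianProductWith f (x ∷ₗ xs) ys = begin
  length (map (f x) ys ++ₗ cartesianProductWith f xs ys)        ≡⟨ length-++ (map (f x) ys) ⟩
  length (map (f x) ys) + length (cartesianProductWith f xs ys) ≡⟨ cong₂ _+_ (length-map (f x) ys)
                                                                             (length-cartesianProductWith f xs ys) ⟩
  length ys + length xs * length ys                             ∎
  where open ≡-Reasoning

∃≥-average : ∀ {n} .{{_ : NonZero n}} (f : Fin n → ℕ) a → n * a ≤ sum f → ∃ λ i → a ≤ f i
∃≥-average {suc n} f a n*a≤∑f with a ≤? f zero
... | yes a≤f₀ = zero , a≤f₀
∃≥-average {suc zero}    f a a≤f₀  | no a≰f₀ =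
  ⊥-elim (a≰f₀ (subst₂ _≤_ (+-identityʳ a) (+-identityʳ (f zero)) a≤f₀))
∃≥-average {suc (suc n)} f a n*a≤∑f | no a≰f₀ =
  let i , a≤fi = ∃≥-average (f ∘ suc) a (+-cancelˡ-≤ a _ _ (≤-trans n*a≤∑f (+-monoˡ-≤ _ (<⇒≤ (≰⇒> a≰f₀)))))
  in  suc i , a≤fi

[m%d+n]%d≡[m+n]%d : ∀ m n d .{{_ : NonZero d}} → (m % d + n) % d ≡ (m + n) % d
[m%d+n]%d≡[m+n]%d m n d = begin
  (m % d + n) % d         ≡⟨ %-distribˡ-+ (m % d) n d ⟩
  (m % d % d + n % d) % d ≡⟨ cong (λ k → (k + n % d) % d) (m%n%n≡m%n m d) ⟩
  (m % d + n % d) % d     ≡⟨ %-distribˡ-+ m n d ⟨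
  (m + n) % d             ∎
  where open ≡-Reasoning

module Rotation (s : ℕ) .{{_ : NonZero s}} where

  rotate : ℕ → Fin s → Fin s
  rotate d x = (toℕ x + d) mod s

  rotate-rotate : ∀ d e x → rotate d (rotate e x) ≡ rotate (e + d) x
  rotate-rotate d e x = toℕ-injective (begin
    toℕ (rotate d (rotate e x))  ≡⟨ toℕ-fromℕ< _ ⟩
    (toℕ (rotate e x) + d) % s   ≡⟨ cong (λ k → (k + d) % s) (toℕ-fromℕ< _) ⟩
    ((toℕ x + e) % s + d) % s    ≡⟨ [m%d+n]%d≡[m+n]%d (toℕ x + e) d s ⟩
    (toℕ x + e + d) % s          ≡⟨ cong (_% s) (+-assoc (toℕ x) e d) ⟩
    (toℕ x + (e + d)) % s        ≡⟨ toℕ-fromℕ< _ ⟨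
    toℕ (rotate (e + d) x)       ∎)
    where open ≡-Reasoning

  rotate-s : ∀ x → rotate s x ≡ x
  rotate-s x = toℕ-injective (begin
    toℕ (rotate s x)  ≡⟨ toℕ-fromℕ< _ ⟩
    (toℕ x + s) % s   ≡⟨ [m+n]%n≡m%n (toℕ x) s ⟩
    toℕ x % s         ≡⟨ m<n⇒m%n≡m (toℕ<n x) ⟩
    toℕ x             ∎)
    where open ≡-Reasoning

  rotation : Fin s → Permutation′ s
  rotation u = permutation (rotate (toℕ u)) (rotate (s ∸ toℕ u))
    (λ y → trans (rotate-rotate _ _ y) (trans (cong (λ d → rotate d y) (m∸n+n≡m u≤s)) (rotate-s y)))
    (λ x → trans (rotate-rotate _ _ x) (trans (cong (λ d → rotate d x) (m+[n∸m]≡n u≤s)) (rotate-s x)))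
    where
    u≤s : toℕ u ≤ s
    u≤s = <⇒≤ (toℕ<n u)

  rotation-comm : ∀ u x → rotation u ⟨$⟩ʳ x ≡ rotation x ⟨$⟩ʳ u
  rotation-comm u x = cong (_mod s) (+-comm (toℕ x) (toℕ u))

  ∑-rotations : ∀ (f : Fin s → ℕ) x → ∑[ u < s ] f (rotation u ⟨$⟩ʳ x) ≡ sum f
  ∑-rotations f x = trans (sum-cong-≗ {s} (cong f ∘ λ u → rotation-comm u x)) (sym (sum-permute f (rotation x)))

  ∑∣∩preimage-rotation∣ : ∀ (S R : Subset s) → ∑[ u < s ] ∣ S ∩ preimage (rotation u ⟨$⟩ʳ_) R ∣ ≡ ∣ S ∣ * ∣ R ∣
  ∑∣∩preimage-rotation∣ S R = begin
    ∑[ u < s ] ∣ S ∩ preimage (rotation u ⟨$⟩ʳ_) R ∣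
      ≡⟨ sum-cong-≗ {s} (λ u → trans (∣p∩q∣≡∑ S _)
                          (sum-cong-≗ {s} (λ x → cong ((𝟙S x *_) ∘ iverson) (lookup∘tabulate _ x)))) ⟩
    ∑[ u < s ] ∑[ x < s ] (𝟙S x * 𝟙R (rotation u ⟨$⟩ʳ x))
      ≡⟨ ∑-comm (λ u x → 𝟙S x * 𝟙R (rotation u ⟨$⟩ʳ x)) ⟩
    ∑[ x < s ] ∑[ u < s ] (𝟙S x * 𝟙R (rotation u ⟨$⟩ʳ x))
      ≡⟨ sum-cong-≗ {s} (λ x → sym (*-distribˡ-sum (𝟙S x) (λ u → 𝟙R (rotation u ⟨$⟩ʳ x)))) ⟩
    ∑[ x < s ] (𝟙S x * ∑[ u < s ] 𝟙R (rotation u ⟨$⟩ʳ x))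
      ≡⟨ sum-cong-≗ {s} (λ x → cong (𝟙S x *_) (trans (∑-rotations 𝟙R x) (sym (∣p∣≡∑ R)))) ⟩
    ∑[ x < s ] (𝟙S x * ∣ R ∣)
      ≡⟨ *-distribʳ-sum ∣ R ∣ 𝟙S ⟨
    sum 𝟙S * ∣ R ∣
      ≡⟨ cong (_* ∣ R ∣) (∣p∣≡∑ S) ⟨
    ∣ S ∣ * ∣ R ∣ ∎
    where
    open ≡-Reasoning
    𝟙S 𝟙R : Fin s → ℕ
    𝟙S = iverson ∘ lookup S
    𝟙R = iverson ∘ lookup R

  ∃-rotation-keeping-half : ∀ (S R : Subset s) → s ≤ 2 * ∣ R ∣ →
    ∃ λ u → ∣ S ∣ ≤ 2 * ∣ S ∩ preimage (rotation u ⟨$⟩ʳ_) R ∣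
  ∃-rotation-keeping-half S R s≤2∣R∣ = ∃≥-average (λ u → 2 * ∣ S ∩ preimage (rotation u ⟨$⟩ʳ_) R ∣) ∣ S ∣ (begin
    s * ∣ S ∣                                            ≤⟨ *-monoˡ-≤ ∣ S ∣ s≤2∣R∣ ⟩
    2 * ∣ R ∣ * ∣ S ∣                                    ≡⟨ *-assoc 2 ∣ R ∣ ∣ S ∣ ⟩
    2 * (∣ R ∣ * ∣ S ∣)                                  ≡⟨ cong (2 *_) (*-comm ∣ R ∣ ∣ S ∣) ⟩
    2 * (∣ S ∣ * ∣ R ∣)                                  ≡⟨ cong (2 *_) (∑∣∩preimage-rotation∣ S R) ⟨
    2 * ∑[ u < s ] ∣ S ∩ preimage (rotation u ⟨$⟩ʳ_) R ∣   ≡⟨ *-distribˡ-sum {s} 2 _ ⟩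
    ∑[ u < s ] (2 * ∣ S ∩ preimage (rotation u ⟨$⟩ʳ_) R ∣) ∎)
    where open ≤-Reasoning

Coloured : ∀ {n} → Coloring n → Bool → Subset n → Set
Coloured c b e = ∀ v → v ∈ e → c v ≡ b

Coloured-⊥ : ∀ {n} {c : Coloring n} {b} → Coloured c b ⊥
Coloured-⊥ v v∈⊥ = ⊥-elim (∉⊥ v∈⊥)

Coloured-++ : ∀ {m n} {c : Coloring (m + n)} {b} {p : Subset m} {q : Subset n} →
  Coloured (c ∘ (_↑ˡ n)) b p → Coloured (c ∘ (m ↑ʳ_)) b q → Coloured c b (p ++ q)
Coloured-++ {p = []}            _          q-coloured v       v∈q        = q-coloured v v∈q
Coloured-++ {p = _ ∷ _}         p-coloured _          zero    here       = p-coloured zero here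
Coloured-++ {c = c} {p = _ ∷ _} p-coloured q-coloured (suc v) (there v∈) =
  Coloured-++ {c = c ∘ suc} (λ i i∈p → p-coloured (suc i) (there i∈p)) q-coloured v v∈

colourClass : ∀ {n} → Coloring n → Bool → Subset n
colourClass c true  = tabulate c
colourClass c false = ∁ (tabulate c)

Coloured-colourClass : ∀ {n} (c : Coloring n) b → Coloured c b (colourClass c b)
Coloured-colourClass c true  v v∈ = trans (sym (lookup∘tabulate c v)) ([]=⇒lookup v∈)
Coloured-colourClass c false v v∈ with c v in cv≡
... | true  = ⊥-elim (x∈∁p⇒x∉p v∈ (lookup⇒[]= v _ (trans (lookup∘tabulate c v) cv≡)))
... | false = refl

∣colourClass∣+∣colourClass∣≡n : ∀ {n} (c : Coloring n) → ∣ colourClass c true ∣ + ∣ colourClass c false ∣ ≡ n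
∣colourClass∣+∣colourClass∣≡n c =
  trans (cong (∣ tabulate c ∣ +_) (∣∁p∣≡n∸∣p∣ (tabulate c))) (m+[n∸m]≡n (∣p∣≤n (tabulate c)))

Majority : ∀ {n} → Coloring n → Bool → Set
Majority {n} c b = n ≤ 2 * ∣ colourClass c b ∣

-- Opaque, so that 'with majority? c b' can abstract it in goals; unfolded, it reduces to _≤ᵇ_ first.
opaque
  majority? : ∀ {n} (c : Coloring n) b → Dec (Majority c b)
  majority? {n} c b = n ≤? 2 * ∣ colourClass c b ∣

majorityIndicator : ∀ {n} → Coloring n → Bool → ℕ
majorityIndicator c b = iverson (does (majority? c b))

some-colour-has-majority : ∀ {n} (c : Coloring n) → 1 ≤ majorityIndicator c true + majorityIndicator c false
some-colour-has-majority {n} c with majority? c true | majority? c false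
... | yes _ | _     = s≤s z≤n
... | no _  | yes _ = s≤s z≤n
... | no ¬t | no ¬f = ⊥-elim (<-irrefl 2t+2f≡n+n (+-mono-< (≰⇒> ¬t) (≰⇒> ¬f)))
  where
  t f : ℕ
  t = ∣ colourClass c true ∣
  f = ∣ colourClass c false ∣
  2t+2f≡n+n : 2 * t + 2 * f ≡ n + n
  2t+2f≡n+n = begin
    2 * t + 2 * f  ≡⟨ *-distribˡ-+ 2 t f ⟨
    2 * (t + f)    ≡⟨ cong (2 *_) (∣colourClass∣+∣colourClass∣≡n c) ⟩
    2 * n          ≡⟨ cong (n +_) (+-identityʳ n) ⟩
    n + n          ∎
    where open ≡-Reasoning

module Blocks (s : ℕ) .{{_ : NonZero s}} where

  open Rotation s

  headBlock : ∀ g → Coloring (suc g * s) → Coloring s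
  headBlock g c = c ∘ (_↑ˡ g * s)

  tailBlocks : ∀ g → Coloring (suc g * s) → Coloring (g * s)
  tailBlocks g c = c ∘ (s ↑ʳ_)

  majorityCount : ∀ g → Coloring (g * s) → Bool → ℕ
  majorityCount zero    c b = 0
  majorityCount (suc g) c b = majorityIndicator (headBlock g c) b + majorityCount g (tailBlocks g c) b

  majorityCount-total : ∀ g (c : Coloring (g * s)) → g ≤ majorityCount g c true + majorityCount g c false
  majorityCount-total zero    c = z≤n
  majorityCount-total (suc g) c = begin
    1 + g
      ≤⟨ +-mono-≤ (some-colour-has-majority (headBlock g c)) (majorityCount-total g (tailBlocks g c)) ⟩
    (majorityIndicator (headBlock g c) true + majorityIndicator (headBlock g c) false) +
      (majorityCount g (tailBlocks g c) true + majorityCount g (tailBlocks g c) false)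
      ≡⟨ interchange (majorityIndicator (headBlock g c) true) _ _ _ ⟩
    majorityCount (suc g) c true + majorityCount (suc g) c false ∎
    where open ≤-Reasoning

  ∃-majorityColour : ∀ l g (c : Coloring (g * s)) → 2 * l ≤ suc g → ∃ λ b → l ≤ majorityCount g c b
  ∃-majorityColour l g c 2l≤1+g with l ≤? majorityCount g c true | l ≤? majorityCount g c false
  ... | yes l≤t | _       = true , l≤t
  ... | no _    | yes l≤f = false , l≤f
  ... | no l≰t  | no l≰f  = ⊥-elim (<⇒≱ (s≤s⁻¹ (begin
    suc (suc (t + f)) ≡⟨ cong suc (+-suc t f) ⟨
    suc t + suc f     ≤⟨ +-mono-≤ (≰⇒> l≰t) (≰⇒> l≰f) ⟩
    l + l             ≡⟨ cong (l +_) (+-identityʳ l) ⟨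
    2 * l             ≤⟨ 2l≤1+g ⟩
    suc g             ∎)) (majorityCount-total g c))
    where
    open ≤-Reasoning
    t f : ℕ
    t = majorityCount g c true
    f = majorityCount g c false

  data Choice : ℕ → ℕ → Set where
    done : Choice 0 0
    skip : ∀ {g j} → Choice g j → Choice (suc g) j
    pick : ∀ {g j} → Fin s → Choice g j → Choice (suc g) (suc j)

  edge : ∀ {g j} → Choice g j → Subset s → Subset (g * s)
  edge done        A = []
  edge (skip ch)   A = ⊥ ++ edge ch A
  edge (pick u ch) A = image (rotation u) A ++ edge ch A

  ∣edge∣≡j*∣A∣ : ∀ {g j} (ch : Choice g j) A → ∣ edge ch A ∣ ≡ j * ∣ A ∣
  ∣edge∣≡j*∣A∣ done        A = refl
  ∣edge∣≡j*∣A∣ (skip ch)   A = trans (∣⊥++p∣≡∣p∣ s (edge ch A)) (∣edge∣≡j*∣A∣ ch A)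
  ∣edge∣≡j*∣A∣ (pick u ch) A = trans (∣p++q∣≡∣p∣+∣q∣ (image (rotation u) A) (edge ch A))
                                     (cong₂ _+_ (∣image∣≡∣p∣ (rotation u) A) (∣edge∣≡j*∣A∣ ch A))

  choices : ∀ g j → List (Choice g j)
  choices zero    zero    = done ∷ₗ []ₗ
  choices zero    (suc j) = []ₗ
  choices (suc g) zero    = map skip (choices g zero)
  choices (suc g) (suc j) = map skip (choices g (suc j)) ++ₗ cartesianProductWith pick (allFin s) (choices g j)

  length-choices : ∀ g j → length (choices g j) ≡ (g C j) * s ^ j
  length-choices zero    zero    = refl
  length-choices zero    (suc j) = refl
  length-choices (suc g) zero    = trans (length-map skip (choices g zero)) (length-choices g zero)
  length-choices (suc g) (suc j) = begin
    length (map skip skips ++ₗ cartesianProductWith pick (allFin s) picks)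
      ≡⟨ length-++ (map skip skips) ⟩
    length (map skip skips) + length (cartesianProductWith pick (allFin s) picks)
      ≡⟨ cong₂ _+_ (length-map skip skips) (length-cartesianProductWith pick (allFin s) picks) ⟩
    length skips + length (allFin s) * length picks
      ≡⟨ cong₂ _+_ (length-choices g (suc j)) (cong₂ _*_ (length-tabulate {n = s} id) (length-choices g j)) ⟩
    (g C suc j) * s ^ suc j + s * ((g C j) * s ^ j)
      ≡⟨ cong ((g C suc j) * s ^ suc j +_) (x*yz≡y*xz s (g C j) (s ^ j)) ⟩
    (g C suc j) * s ^ suc j + (g C j) * s ^ suc j
      ≡⟨ *-distribʳ-+ (s ^ suc j) (g C suc j) (g C j) ⟨
    (g C suc j + g C j) * s ^ suc j
      ≡⟨ cong (_* s ^ suc j) (trans (+-comm (g C suc j) (g C j)) (nCk+nC[k+1]≡[n+1]C[k+1] g j)) ⟩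
    (suc g C suc j) * s ^ suc j ∎
    where
    open ≡-Reasoning
    skips = choices g (suc j)
    picks = choices g j

  ∈-choices : ∀ {g j} (ch : Choice g j) → ch ∈ₗ choices g j
  ∈-choices done                  = here refl
  ∈-choices (skip {j = zero}  ch) = ∈-map⁺ skip (∈-choices ch)
  ∈-choices (skip {j = suc j} ch) = ∈-++⁺ˡ (∈-map⁺ skip (∈-choices ch))
  ∈-choices (pick u ch)           = ∈-++⁺ʳ (map skip _) (∈-cartesianProductWith⁺ pick (∈-allFin u) (∈-choices ch))

  record ColouredChoice g j (c : Coloring (g * s)) (b : Bool) (S : Subset s) : Set where
    field
      choice              : Choice g j
      survivors           : Subset s
      survivors⊆S         : survivors ⊆ S
      ∣S∣≤2^j*∣survivors∣ : ∣ S ∣ ≤ 2 ^ j * ∣ survivors ∣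
      coloured            : ∀ {A} → A ⊆ survivors → Coloured c b (edge choice A)

  skip-ColouredChoice : ∀ {g j c b S} → ColouredChoice g j (tailBlocks g c) b S → ColouredChoice (suc g) j c b S
  skip-ColouredChoice cc = record
    { choice   = skip choice ; survivors = survivors ; survivors⊆S = survivors⊆S
    ; ∣S∣≤2^j*∣survivors∣ = ∣S∣≤2^j*∣survivors∣
    ; coloured = λ A⊆ → Coloured-++ Coloured-⊥ (coloured A⊆) }
    where open ColouredChoice cc

  pick-ColouredChoice : ∀ {g j c b S} u → let R = colourClass (headBlock g c) b; S₁ = S ∩ preimage (rotation u ⟨$⟩ʳ_) R in
    ∣ S ∣ ≤ 2 * ∣ S₁ ∣ → ColouredChoice g j (tailBlocks g c) b S₁ → ColouredChoice (suc g) (suc j) c b S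
  pick-ColouredChoice {g} {j} {c} {b} {S} u ∣S∣≤2∣S₁∣ cc = record
    { choice   = pick u choice ; survivors = survivors
    ; survivors⊆S = ⊆-trans survivors⊆S (p∩q⊆p S _)
    ; ∣S∣≤2^j*∣survivors∣ = begin
        ∣ S ∣                         ≤⟨ ∣S∣≤2∣S₁∣ ⟩
        2 * ∣ S₁ ∣                    ≤⟨ *-monoʳ-≤ 2 ∣S∣≤2^j*∣survivors∣ ⟩
        2 * (2 ^ j * ∣ survivors ∣)   ≡⟨ *-assoc 2 (2 ^ j) ∣ survivors ∣ ⟨
        2 ^ suc j * ∣ survivors ∣     ∎
    ; coloured = λ A⊆ → Coloured-++ (head-coloured A⊆) (coloured A⊆) }
    where
    open ColouredChoice cc
    open ≤-Reasoning
    S₁ : Subset s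
    S₁ = S ∩ preimage (rotation u ⟨$⟩ʳ_) (colourClass (headBlock g c) b)
    head-coloured : ∀ {A} → A ⊆ survivors → Coloured (headBlock g c) b (image (rotation u) A)
    head-coloured A⊆ v v∈ = Coloured-colourClass (headBlock g c) b v
      (⊆-preimage⇒image⊆ (rotation u) (⊆-trans A⊆ (⊆-trans survivors⊆S (p∩q⊆q S _))) v∈)

  colouredChoice : ∀ g j (c : Coloring (g * s)) b → j ≤ majorityCount g c b → ∀ S → ColouredChoice g j c b S
  colouredChoice zero    zero    c b _ S = record
    { choice = done ; survivors = S ; survivors⊆S = id
    ; ∣S∣≤2^j*∣survivors∣ = ≤-reflexive (sym (*-identityˡ ∣ S ∣)) ; coloured = λ _ () }
  colouredChoice (suc g) zero    c b _ S = skip-ColouredChoice (colouredChoice g zero (tailBlocks g c) b z≤n S)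
  colouredChoice (suc g) (suc j) c b 1+j≤count S with majority? (headBlock g c) b
  ... | no _    = skip-ColouredChoice (colouredChoice g (suc j) (tailBlocks g c) b 1+j≤count S)
  ... | yes maj =
    let u , ∣S∣≤2∣S₁∣ = ∃-rotation-keeping-half S (colourClass (headBlock g c) b) maj
    in  pick-ColouredChoice u ∣S∣≤2∣S₁∣ (colouredChoice g j (tailBlocks g c) b (s≤s⁻¹ 1+j≤count) _)

  candidateEdges : ∀ g j q → List (Subset (g * s))
  candidateEdges g j q = cartesianProductWith edge (choices g j) (subsetsOfSize s q)

  length-candidateEdges : ∀ g j q → length (candidateEdges g j q) ≡ (g C j) * s ^ j * (s C q)
  length-candidateEdges g j q = begin
    length (candidateEdges g j q)                      ≡⟨ length-cartesianProductWith edge (choices g j) (subsetsOfSize s q) ⟩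
    length (choices g j) * length (subsetsOfSize s q)  ≡⟨ cong₂ _*_ (length-choices g j) (length-subsetsOfSize s q) ⟩
    (g C j) * s ^ j * (s C q)                          ∎
    where open ≡-Reasoning

  candidateEdges-uniform : ∀ g j q → All (λ e → ∣ e ∣ ≡ j * q) (candidateEdges g j q)
  candidateEdges-uniform g j q = All.tabulate λ e∈ →
    let ch , A , _ , A∈ , e≡ = ∈-cartesianProductWith⁻ edge (choices g j) (subsetsOfSize s q) e∈
    in  trans (cong ∣_∣ e≡) (trans (∣edge∣≡j*∣A∣ ch A) (cong (j *_) (∈-subsetsOfSize⁻ q A∈)))

  candidateEdges-monochromatic : ∀ l g q → s ≡ 2 ^ l * q → 2 * l ≤ suc g →
    (c : Coloring (g * s)) → Any (Monochromatic c) (candidateEdges g l q)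
  candidateEdges-monochromatic l g q s≡2^l*q 2l≤1+g c with ∃-majorityColour l g c 2l≤1+g
  ... | b , l≤count = monochromatic-edge (colouredChoice g l c b l≤count ⊤)
    where
    monochromatic-edge : ColouredChoice g l c b ⊤ → Any (Monochromatic c) (candidateEdges g l q)
    monochromatic-edge cc =
      let A , A⊆survivors , ∣A∣≡q = ∃⊆-ofSize q survivors q≤∣survivors∣
          A∈ = subst (λ k → A ∈ₗ subsetsOfSize s k) ∣A∣≡q (∈-subsetsOfSize A)
      in  lose (∈-cartesianProductWith⁺ edge (∈-choices choice) A∈) (b , coloured A⊆survivors)
      where
      open ColouredChoice cc
      q≤∣survivors∣ : q ≤ ∣ survivors ∣
      q≤∣survivors∣ = *-cancelˡ-≤ (2 ^ l) {{m^n≢0 2 l}} (begin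
        2 ^ l * q             ≡⟨ s≡2^l*q ⟨
        s                     ≡⟨ ∣⊤∣≡n s ⟨
        ∣ ⊤ {s} ∣             ≤⟨ ∣S∣≤2^j*∣survivors∣ ⟩
        2 ^ l * ∣ survivors ∣ ∎)
        where open ≤-Reasoning

padding : ∀ k r → List (Subset (r * k))
padding k zero    = []ₗ
padding k (suc r) = (⊤ {k} ++ ⊥ {r * k}) ∷ₗ map (⊥ {k} ++_) (padding k r)

length-padding : ∀ k r → length (padding k r) ≡ r
length-padding k zero    = refl
length-padding k (suc r) = cong suc (trans (length-map (⊥ {k} ++_) (padding k r)) (length-padding k r))

padding-uniform : ∀ k r → All (λ e → ∣ e ∣ ≡ k) (padding k r)
padding-uniform k zero    = All.[]
padding-uniform k (suc r) =
  trans (∣p++⊥∣≡∣p∣ (r * k) (⊤ {k})) (∣⊤∣≡n k) All.∷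
  Allₚ.map⁺ (All.map (λ {e} → trans (∣⊥++p∣≡∣p∣ k e)) (padding-uniform k r))

padding-unique : ∀ {k} r → 0 < k → Unique (padding k r)
padding-unique zero    _ = AllPairs.[]
padding-unique {suc k} (suc r) _ =
  All.tabulate ⊤++⊥∉ AllPairs.∷ Uniqueₚ.map⁺ (++-injectiveʳ ⊥ ⊥) (padding-unique r (s≤s z≤n))
  where
  ⊤++⊥∉ : ∀ {e} → e ∈ₗ map (⊥ ++_) (padding (suc k) r) → ⊤ {suc k} ++ ⊥ {r * suc k} ≢ e
  ⊤++⊥∉ e∈ eq with ∈-map⁻ (⊥ ++_) e∈
  ... | _ , _ , refl with ++-injectiveˡ (⊤ {suc k}) ⊥ eq
  ... | ()

hypergraph-from-edge-list : ∀ {n k} → 0 < k → (L : List (Subset n)) → All (λ e → ∣ e ∣ ≡ k) L →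
  (∀ c → Any (Monochromatic c) L) →
  Σ ℕ λ n′ → Σ (Hypergraph n′) λ H → Uniform k H × ¬ TwoColorable H × numEdges H ≡ length L
hypergraph-from-edge-list {n} {k} k>0 L L-uniform L-monochromatic =
  n + r * k , H , H-uniform , H-uncolourable , #H≡#L
  where
  _≟ₛ_ : (p q : Subset n) → Dec (p ≡ q)
  _≟ₛ_ = ≡-dec Bool._≟_
  D : List (Subset n)
  D = deduplicate _≟ₛ_ L
  r : ℕ
  r = length L ∸ length D
  old new : List (Subset (n + r * k))
  old = map (_++ ⊥) D
  new = map (⊥ ++_) (padding k r)
  old-new-disjoint : ∀ {e} → ¬ (e ∈ₗ old × e ∈ₗ new)
  old-new-disjoint (e∈old , e∈new) with ∈-map⁻ (_++ ⊥) e∈old | ∈-map⁻ (⊥ ++_) e∈new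
  ... | e , _ , refl | e′ , e′∈ , eq with ++-injectiveʳ e ⊥ eq
  ... | refl = <-irrefl (trans (sym (∣⊥∣≡0 (r * k))) (All.lookup (padding-uniform k r) e′∈)) k>0
  H : Hypergraph (n + r * k)
  H = record
    { edges    = old ++ₗ new
    ; distinct = Uniqueₚ.++⁺ (Uniqueₚ.map⁺ (++-injectiveˡ _ _) (deduplicate-! _≟ₛ_ L))
                             (Uniqueₚ.map⁺ (++-injectiveʳ ⊥ ⊥) (padding-unique r k>0))
                             old-new-disjoint
    }
  H-uniform : Uniform k H
  H-uniform = Allₚ.++⁺
    (Allₚ.map⁺ (All.map (λ {e} → trans (∣p++⊥∣≡∣p∣ (r * k) e)) (Allₚ.deduplicate⁺ _≟ₛ_ L-uniform)))
    (Allₚ.map⁺ (All.map (λ {e} → trans (∣⊥++p∣≡∣p∣ n e)) (padding-uniform k r)))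
  H-uncolourable : ¬ TwoColorable H
  H-uncolourable (c , proper) with find (L-monochromatic (c ∘ (_↑ˡ r * k)))
  ... | e , e∈L , b , coloured =
    proper (e ++ ⊥) (∈-++⁺ˡ (∈-map⁺ (_++ ⊥) (∈-deduplicate⁺ _≟ₛ_ e∈L))) (b , Coloured-++ coloured Coloured-⊥)
  #H≡#L : numEdges H ≡ length L
  #H≡#L = begin
    length (old ++ₗ new)     ≡⟨ length-++ old ⟩
    length old + length new  ≡⟨ cong₂ _+_ (length-map _ D) (trans (length-map _ (padding k r)) (length-padding k r)) ⟩
    length D + r             ≡⟨ m+[n∸m]≡n (length-deduplicate _≟ₛ_ L) ⟩
    length L                 ∎
    where open ≡-Reasoning

theorem1p1 : (k l : ℕ) → (k>0 : 0 < k) → (l>0 : 0 < l) → l ≤ k → l ∣ k →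
    Σ ℕ λ n → Σ (Hypergraph n) λ H →
      Uniform k H × ¬ TwoColorable H × numEdges H ≡ m k l {{>-nonZero l>0}}
theorem1p1 k l k>0 l>0 l≤k l∣k =
  let n , H , H-uniform , H-uncolourable , #H≡#L =
        hypergraph-from-edge-list k>0 (candidateEdges g l q) uniform (candidateEdges-monochromatic l g q refl 2l≤1+g)
  in  n , H , H-uniform , H-uncolourable , trans #H≡#L (length-candidateEdges g l q)
  where
  instance
    l≢0 : NonZero l
    l≢0 = >-nonZero l>0
  q s g : ℕ
  q = k / l
  s = 2 ^ l * q
  g = 2 * l ∸ 1
  instance
    s≢0 : NonZero s
    s≢0 = m*n≢0 (2 ^ l) q {{m^n≢0 2 l}} {{>-nonZero (m≥n⇒m/n>0 l≤k)}}
  open Blocks s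
  2l≤1+g : 2 * l ≤ suc g
  2l≤1+g = ≤-reflexive (sym (m+[n∸m]≡n (≤-trans l>0 (m≤m+n l (l + 0)))))
  uniform : All (λ e → ∣ e ∣ ≡ k) (candidateEdges g l q)
  uniform = All.map (λ ∣e∣≡lq → trans ∣e∣≡lq (m*[n/m]≡n l∣k)) (candidateEdges-uniform g l q)
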